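{- Let $n\ge 19$ with $n\equiv 1\pmod 3$. Then there exists a $5$-uniform hypergraph $\mathcal{H}=(V,\mathcal{E})$ with $EI(\mathcal{H})=C_n$ and $|\mathcal{E}|=\frac{2}{3}(n-1)+1$ such that $\mathcal{H}$ contains exactly one $(5)$-hyperedge, exactly one $(2,2,1)$-hyperedge, and all remaining hyperedges of $\mathcal{H}$ are $(3,2)$-hyperedges.
   Context: Hypergraphs $\mathcal{H}=(V,\mathcal{E})$ have no multiple hyperedges; isolated vertices are allowed. $\mathcal{H}$ is $5$-uniform if every hyperedge has exactly $5$ elements. The edge intersection hypergraph of $\mathcal{H}$ is $EI(\mathcal{H})=(V,\mathcal{E}^{EI})$ with $\mathcal{E}^{EI}=\{e_1\cap e_2: e_1,e_2\in\mathcal{E},\ e_1\ne e_2,\ |e_1\cap e_2|\ge 2\}$. $C_n$ is the cycle with vertex set $\{1,\dots,n\}$ and edges $\{i,i+1\}$, $i=1,\dots,n$ (vertices taken mod $n$); "$EI(\mathcal{H})=C_n$" means $V=\{1,\dots,n\}$ and $\mathcal{E}^{EI}$ is exactly the edge set of $C_n$. For $e\in\mathcal{E}$, a $k$-section of $e$ is a sequence $(i,i+1,\dots,i+k-1)$ of cyclically consecutive vertices with $\{i,\dots,i+k-1\}\subseteq e$, $i-1\notin e$, $i+k\notin e$ (mod $n$). A hyperedge $e$ is an $(l_1,\dots,l_t)$-hyperedge ($l_1\ge\dots\ge l_t$) if $e$ is the disjoint union of exactly $t$ sections, of cardinalities $l_1,\dots,l_t$. -}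

module Defs where

open import Data.Nat using (ℕ; _+_; _∸_; _<_; NonZero)
open import Data.Nat.DivMod using (_mod_)
open import Data.Fin using (Fin; toℕ)
open import Data.Fin.Subset using (Subset; _∈_; _∉_; _∩_; _∪_; ⁅_⁆; ⋃; ∣_∣) renaming (⊥ to ∅)
open import Data.List using (List; map; upTo)
open import Data.List.Membership.Propositional using () renaming (_∈_ to _∈ˡ_)
open import Data.List.Relation.Unary.All using (All)
open import Data.List.Relation.Unary.AllPairs using (AllPairs)
open import Data.List.Relation.Unary.Unique.Propositional using (Unique)
open import Data.List.Relation.Binary.Permutation.Propositional using (_↭_)
open import Data.Product using (Σ; _×_; _,_; proj₁; proj₂; ∃)
open import Relation.Binary.PropositionalEquality using (_≡_; _≢_)

-- Vertices {1,…,n} are represented by Fin n = {0,…,n-1} (vertex j ↦ j-1).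
-- Cyclic shift of vertex i by k (mod n).
shift : ∀ {n} .{{_ : NonZero n}} → Fin n → ℕ → Fin n
shift {n} i k = (toℕ i + k) mod n

pred : ∀ {n} .{{_ : NonZero n}} → Fin n → Fin n
pred {n} i = shift i (n ∸ 1)

cycleEdge : ∀ {n} .{{_ : NonZero n}} → Fin n → Subset n
cycleEdge i = ⁅ i ⁆ ∪ ⁅ shift i 1 ⁆

record Hypergraph (n : ℕ) : Set where
  field
    edges  : List (Subset n)
    unique : Unique edges
open Hypergraph public

Uniform : ∀ {n} → ℕ → Hypergraph n → Set
Uniform k H = ∀ e → e ∈ˡ edges H → ∣ e ∣ ≡ k

IsEIEdge : ∀ {n} → Hypergraph n → Subset n → Set
IsEIEdge H s = ∃ λ e₁ → ∃ λ e₂ → e₁ ∈ˡ edges H × e₂ ∈ˡ edges H × e₁ ≢ e₂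
                 × 2 Data.Nat.≤ ∣ e₁ ∩ e₂ ∣ × e₁ ∩ e₂ ≡ s

IsCycleEdge : ∀ {n} .{{_ : NonZero n}} → Subset n → Set
IsCycleEdge {n} s = ∃ λ (i : Fin n) → cycleEdge i ≡ s

EIisCycle : ∀ {n} .{{_ : NonZero n}} → Hypergraph n → Set
EIisCycle H = (∀ s → IsEIEdge H s → IsCycleEdge s) × (∀ s → IsCycleEdge s → IsEIEdge H s)

sectionSet : ∀ {n} .{{_ : NonZero n}} → Fin n → ℕ → Subset n
sectionSet i k = ⋃ (map (λ j → ⁅ shift i j ⁆) (upTo k))

IsSection : ∀ {n} .{{_ : NonZero n}} → Subset n → Fin n → ℕ → Set
IsSection e i k = (∀ j → j < k → shift i j ∈ e) × pred i ∉ e × shift i k ∉ e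

Disjoint : ∀ {n} → Subset n → Subset n → Set
Disjoint a b = a ∩ b ≡ ∅

IsTypeHyperedge : ∀ {n} .{{_ : NonZero n}} → List ℕ → Subset n → Set
IsTypeHyperedge {n} ls e =
  Σ (List (Fin n × ℕ)) λ ss →
      All (λ s → IsSection e (proj₁ s) (proj₂ s)) ss
    × AllPairs (λ s t → Disjoint (sectionSet (proj₁ s) (proj₂ s)) (sectionSet (proj₁ t) (proj₂ t))) ss
    × ⋃ (map (λ s → sectionSet (proj₁ s) (proj₂ s)) ss) ≡ e
    × map (λ s → ∣ sectionSet (proj₁ s) (proj₂ s) ∣) ss ↭ ls

-- Write n = 3m + 1 and use the vertices 0, …, n - 1. For j < m - 2 the (3,2)-hyperedges
-- X_j = {3j, 3j+1, 3j+2, 3j+8, 3j+9} and Y_j = {3j+1, 3j+2, 3j+3, 3j+6, 3j+7} produce the cycle edges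
-- {3j+1, 3j+2} = X_j ∩ Y_j, {3j+6, 3j+7} = Y_j ∩ X_{j+2} and {3j+8, 3j+9} = X_j ∩ Y_{j+2}; five hyperedges
-- placed at n - 8, among them the (5)-hyperedge {n-6, …, n-2} and the (2,2,1)-hyperedge
-- {n-4, n-1, 0, 3, 4}, close the cycle. Every hyperedge is a translate of a pattern of offsets inside a
-- window of width 15, so two hyperedges with nearby bases meet in a set read off their patterns (at most
-- one vertex, or an edge of C_n), while hyperedges with distant bases are disjoint; the type of a
-- hyperedge is read off its pattern as well. For n = 19 and n = 22 the meets and the covering of C_n
-- are checked by evaluation.

module Submission where

open import Defs
open import Data.Bool using (true; false)
import Data.Bool.Properties as Bool
open import Data.Empty using (⊥-elim)
open import Data.Fin using (Fin; toℕ)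
import Data.Fin.Properties as Fin
open import Data.Fin.Subset using (Subset; _∩_; _∪_; ⁅_⁆; ⋃; ∣_∣; _⊆_)
  renaming (⊥ to ∅; _∈_ to _∈ˢ_; _∉_ to _∉ˢ_)
open import Data.Fin.Subset.Properties
  using (x∈p∪q⁺; x∈p∪q⁻; x∈p∩q⁺; x∈p∩q⁻; x∈⁅x⁆; x∈⁅y⁆⇒x≡y; ∉⊥; ⊆-antisym; ⊆-min; p⊆q⇒∣p∣≤∣q∣; ∣⁅x⁆∣≡1; ∣⊥∣≡0;
         ∩-comm; ∩-idem; ∪-identityˡ; ∪-identityʳ; ∪-assoc)
open import Data.List using (List; []; _∷_; map; upTo; applyUpTo; length; _++_; filter)
open import Data.List.Properties using (map-∘; map-cong; length-++; length-upTo; length-applyUpTo)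
open import Data.List.Membership.Propositional using (_∈_; _∉_; find; lose)
open import Data.List.Membership.Propositional.Properties
  using (∈-map⁺; ∈-map⁻; ∈-upTo⁺; ∈-upTo⁻; ∈-applyUpTo⁺; ∈-++⁺ˡ; ∈-++⁺ʳ; ∈-filter⁺; ∈-filter⁻)
open import Data.List.Relation.Unary.Any as Any using (Any; here; there)
open import Data.List.Relation.Unary.All as All using (All; []; _∷_)
import Data.List.Relation.Unary.All.Properties as All
open import Data.List.Relation.Unary.AllPairs as AllPairs using (AllPairs; []; _∷_)
import Data.List.Relation.Unary.AllPairs.Properties as AllPairs
open import Data.List.Relation.Unary.Unique.Propositional using (Unique)
import Data.List.Relation.Unary.Unique.Propositional.Properties as Unique
open import Data.List.Relation.Binary.Permutation.Propositional using (↭-sym; ↭-reflexive)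
open import Data.List.Relation.Binary.Permutation.Propositional.Properties using (∈-resp-↭)
open import Data.Nat using (ℕ; zero; suc; _+_; _*_; _∸_; _≤_; _<_; NonZero; z≤n; s≤s; z<s; _≟_; _<?_; _≤?_)
open import Data.Nat.DivMod
  using (_%_; _/_; _mod_; m%n<n; m<n⇒m%n≡m; [m+n]%n≡m%n; %-distribˡ-+; m%n%n≡m%n; m≡m%n+[m/n]*n; m*n/n≡m; /-monoˡ-≤)
open import Data.Nat.Properties
open import Data.Nat.Tactic.RingSolver using (solve-∀)
open import Data.List.Membership.DecPropositional _≟_ using (_∈?_)
open import Data.List.Relation.Unary.Unique.DecPropositional _≟_ using (unique?)
open import Data.Product using (Σ; ∃; _×_; _,_; proj₁; proj₂; map₁)
open import Data.Sum using (_⊎_; inj₁; inj₂; [_,_])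
open import Data.Vec using ([]; _∷_)
import Data.Vec.Properties as Vec
open import Function using (id; _∘_; case_of_)
open import Relation.Binary.Definitions using (tri<; tri≈; tri>)
open import Relation.Binary.PropositionalEquality hiding ([_])
open import Relation.Nullary using (¬_; Dec; yes; no; ¬?; contradiction)
open import Relation.Nullary.Decidable using (True; toWitness; from-yes; map′; _×-dec_; _⊎-dec_)

∣p∪q∣+∣p∩q∣≡∣p∣+∣q∣ : ∀ {k} (p q : Subset k) → ∣ p ∪ q ∣ + ∣ p ∩ q ∣ ≡ ∣ p ∣ + ∣ q ∣
∣p∪q∣+∣p∩q∣≡∣p∣+∣q∣ [] [] = refl
∣p∪q∣+∣p∩q∣≡∣p∣+∣q∣ (true ∷ p) (true ∷ q) =
  cong suc (trans (+-suc _ _) (trans (cong suc (∣p∪q∣+∣p∩q∣≡∣p∣+∣q∣ p q)) (sym (+-suc _ _))))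
∣p∪q∣+∣p∩q∣≡∣p∣+∣q∣ (true ∷ p) (false ∷ q) = cong suc (∣p∪q∣+∣p∩q∣≡∣p∣+∣q∣ p q)
∣p∪q∣+∣p∩q∣≡∣p∣+∣q∣ (false ∷ p) (true ∷ q) = trans (cong suc (∣p∪q∣+∣p∩q∣≡∣p∣+∣q∣ p q)) (sym (+-suc _ _))
∣p∪q∣+∣p∩q∣≡∣p∣+∣q∣ (false ∷ p) (false ∷ q) = ∣p∪q∣+∣p∩q∣≡∣p∣+∣q∣ p q

∣p∪q∣≤∣p∣+∣q∣ : ∀ {k} (p q : Subset k) → ∣ p ∪ q ∣ ≤ ∣ p ∣ + ∣ q ∣
∣p∪q∣≤∣p∣+∣q∣ p q = subst (∣ p ∪ q ∣ ≤_) (∣p∪q∣+∣p∩q∣≡∣p∣+∣q∣ p q) (m≤m+n _ _)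

∣p∪q∣≡∣p∣+∣q∣ : ∀ {k} (p q : Subset k) → (∀ {x} → x ∈ˢ p → x ∉ˢ q) → ∣ p ∪ q ∣ ≡ ∣ p ∣ + ∣ q ∣
∣p∪q∣≡∣p∣+∣q∣ {k} p q disjoint = begin
  ∣ p ∪ q ∣                 ≡⟨ +-identityʳ _ ⟨
  ∣ p ∪ q ∣ + 0             ≡⟨ cong (∣ p ∪ q ∣ +_) ∣p∩q∣≡0 ⟨
  ∣ p ∪ q ∣ + ∣ p ∩ q ∣     ≡⟨ ∣p∪q∣+∣p∩q∣≡∣p∣+∣q∣ p q ⟩
  ∣ p ∣ + ∣ q ∣             ∎
  where
    open ≡-Reasoning
    ∣p∩q∣≡0 : ∣ p ∩ q ∣ ≡ 0
    ∣p∩q∣≡0 = n≤0⇒n≡0 (subst (∣ p ∩ q ∣ ≤_) (∣⊥∣≡0 k)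
      (p⊆q⇒∣p∣≤∣q∣ {q = ∅} λ x∈ → let (x∈p , x∈q) = x∈p∩q⁻ p q x∈ in contradiction x∈q (disjoint x∈p)))

-- Vertices at an offset from a base

range : ℕ → ℕ → List ℕ
range a k = map (a +_) (upTo k)

module _ {n : ℕ} .{{_ : NonZero n}} where

  vertex : ℕ → ℕ → Fin n
  vertex b p = (b + p) mod n

  toℕ-mod : ∀ m → toℕ (m mod n) ≡ m % n
  toℕ-mod m = Fin.toℕ-fromℕ< (m%n<n m n)

  [m%n+k]%n≡[m+k]%n : ∀ m k → (m % n + k) % n ≡ (m + k) % n
  [m%n+k]%n≡[m+k]%n m k = begin
    (m % n + k) % n            ≡⟨ %-distribˡ-+ (m % n) k n ⟩
    (m % n % n + k % n) % n    ≡⟨ cong (λ x → (x + k % n) % n) (m%n%n≡m%n m n) ⟩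
    (m % n + k % n) % n        ≡⟨ %-distribˡ-+ m k n ⟨
    (m + k) % n                ∎
    where open ≡-Reasoning

  vertex-cong : ∀ b p c q → (b + p) % n ≡ (c + q) % n → vertex b p ≡ vertex c q
  vertex-cong b p c q eq = Fin.toℕ-injective (trans (toℕ-mod _) (trans eq (sym (toℕ-mod _))))

  shift-vertex : ∀ b a j → shift (vertex b a) j ≡ vertex b (a + j)
  shift-vertex b a j = vertex-cong (toℕ (vertex b a)) j b (a + j) (begin
    (toℕ (vertex b a) + j) % n  ≡⟨ cong (λ x → (x + j) % n) (toℕ-mod (b + a)) ⟩
    ((b + a) % n + j) % n       ≡⟨ [m%n+k]%n≡[m+k]%n (b + a) j ⟩
    (b + a + j) % n             ≡⟨ cong (_% n) (+-assoc b a j) ⟩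
    (b + (a + j)) % n           ∎)
    where open ≡-Reasoning

  shift-0 : ∀ (i : Fin n) → shift i 0 ≡ i
  shift-0 i = Fin.toℕ-injective (begin
    toℕ (shift i 0)     ≡⟨ toℕ-mod (toℕ i + 0) ⟩
    (toℕ i + 0) % n     ≡⟨ cong (_% n) (+-identityʳ (toℕ i)) ⟩
    toℕ i % n           ≡⟨ m<n⇒m%n≡m (Fin.toℕ<n i) ⟩
    toℕ i               ∎)
    where open ≡-Reasoning

  vertex-rebase : ∀ b₁ b₂ d q → (b₁ + d) % n ≡ b₂ % n → vertex b₂ q ≡ vertex b₁ (d + q)
  vertex-rebase b₁ b₂ d q rel = vertex-cong b₂ q b₁ (d + q) (begin
    (b₂ + q) % n             ≡⟨ [m%n+k]%n≡[m+k]%n b₂ q ⟨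
    (b₂ % n + q) % n         ≡⟨ cong (λ x → (x + q) % n) rel ⟨
    ((b₁ + d) % n + q) % n   ≡⟨ [m%n+k]%n≡[m+k]%n (b₁ + d) q ⟩
    (b₁ + d + q) % n         ≡⟨ cong (_% n) (+-assoc b₁ d q) ⟩
    (b₁ + (d + q)) % n       ∎)
    where open ≡-Reasoning

  pred-vertex : ∀ b a → pred (vertex b (suc a)) ≡ vertex b a
  pred-vertex b a = trans (shift-vertex b (suc a) (n ∸ 1)) (vertex-cong b (suc a + (n ∸ 1)) b a (begin
    (b + (suc a + (n ∸ 1))) % n   ≡⟨ cong (λ x → (b + x) % n) (+-suc a (n ∸ 1)) ⟨
    (b + (a + suc (n ∸ 1))) % n   ≡⟨ cong (λ x → (b + (a + x)) % n) (suc-pred n) ⟩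
    (b + (a + n)) % n             ≡⟨ cong (_% n) (+-assoc b a n) ⟨
    (b + a + n) % n               ≡⟨ [m+n]%n≡m%n (b + a) n ⟩
    (b + a) % n                   ∎))
    where open ≡-Reasoning

  unshift : ∀ {r p} → r ≤ n → p < n → ((r + p) % n + (n ∸ r)) % n ≡ p
  unshift {r} {p} r≤n p<n = begin
    ((r + p) % n + (n ∸ r)) % n   ≡⟨ [m%n+k]%n≡[m+k]%n (r + p) (n ∸ r) ⟩
    (r + p + (n ∸ r)) % n         ≡⟨ cong (_% n) r+p+[n∸r]≡p+n ⟩
    (p + n) % n                   ≡⟨ [m+n]%n≡m%n p n ⟩
    p % n                         ≡⟨ m<n⇒m%n≡m p<n ⟩
    p                             ∎
    where
      open ≡-Reasoning
      r+p+[n∸r]≡p+n : r + p + (n ∸ r) ≡ p + n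
      r+p+[n∸r]≡p+n = begin
        r + p + (n ∸ r)     ≡⟨ cong (_+ (n ∸ r)) (+-comm r p) ⟩
        p + r + (n ∸ r)     ≡⟨ +-assoc p r (n ∸ r) ⟩
        p + (r + (n ∸ r))   ≡⟨ cong (p +_) (m+[n∸m]≡n r≤n) ⟩
        p + n               ∎

  vertex-injective : ∀ b {p q} → p < n → q < n → vertex b p ≡ vertex b q → p ≡ q
  vertex-injective b {p} {q} p<n q<n eq = begin
    p                               ≡⟨ unshift r≤n p<n ⟨
    ((r + p) % n + (n ∸ r)) % n     ≡⟨ cong (λ x → (x + (n ∸ r)) % n) same-residue ⟩
    ((r + q) % n + (n ∸ r)) % n     ≡⟨ unshift r≤n q<n ⟩
    q                               ∎
    where
      open ≡-Reasoning
      r = b % n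
      r≤n = <⇒≤ (m%n<n b n)
      same-residue : (r + p) % n ≡ (r + q) % n
      same-residue = begin
        (r + p) % n          ≡⟨ [m%n+k]%n≡[m+k]%n b p ⟩
        (b + p) % n          ≡⟨ toℕ-mod (b + p) ⟨
        toℕ (vertex b p)     ≡⟨ cong toℕ eq ⟩
        toℕ (vertex b q)     ≡⟨ toℕ-mod (b + q) ⟩
        (b + q) % n          ≡⟨ [m%n+k]%n≡[m+k]%n b q ⟨
        (r + q) % n          ∎

  points : ℕ → List ℕ → Subset n
  points b L = ⋃ (map (λ p → ⁅ vertex b p ⁆) L)

  ∈-points⁺ : ∀ b {L p} → p ∈ L → vertex b p ∈ˢ points b L
  ∈-points⁺ b (here refl) = x∈p∪q⁺ (inj₁ (x∈⁅x⁆ _))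
  ∈-points⁺ b (there p∈) = x∈p∪q⁺ (inj₂ (∈-points⁺ b p∈))

  ∈-points⁻ : ∀ b L {x} → x ∈ˢ points b L → ∃ λ p → p ∈ L × x ≡ vertex b p
  ∈-points⁻ b [] x∈ = contradiction x∈ ∉⊥
  ∈-points⁻ b (p ∷ L) x∈ with x∈p∪q⁻ ⁅ vertex b p ⁆ (points b L) x∈
  ... | inj₁ x∈⁅p⁆ = p , here refl , x∈⁅y⁆⇒x≡y _ x∈⁅p⁆
  ... | inj₂ x∈L with ∈-points⁻ b L x∈L
  ...   | q , q∈ , x≡ = q , there q∈ , x≡

  vertex∈points⇒∈ : ∀ b {L p} → All (_< n) L → p < n → vertex b p ∈ˢ points b L → p ∈ L
  vertex∈points⇒∈ b {L} L<n p<n v∈ with ∈-points⁻ b L v∈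
  ... | q , q∈ , eq = subst (_∈ L) (sym (vertex-injective b p<n (All.lookup L<n q∈) eq)) q∈

  points-⊆ : ∀ b {xs ys} → (∀ {p} → p ∈ xs → p ∈ ys) → points b xs ⊆ points b ys
  points-⊆ b {xs} xs⊆ys x∈ with ∈-points⁻ b xs x∈
  ... | p , p∈ , refl = ∈-points⁺ b (xs⊆ys p∈)

  points-++ : ∀ b xs ys → points b (xs ++ ys) ≡ points b xs ∪ points b ys
  points-++ b [] ys = sym (∪-identityˡ _)
  points-++ b (x ∷ xs) ys = trans (cong (⁅ vertex b x ⁆ ∪_) (points-++ b xs ys)) (sym (∪-assoc _ _ _))

  ∣points∣≤ : ∀ b L → ∣ points b L ∣ ≤ length L
  ∣points∣≤ b [] = ≤-reflexive (∣⊥∣≡0 n)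
  ∣points∣≤ b (p ∷ L) = begin
    ∣ ⁅ vertex b p ⁆ ∪ points b L ∣        ≤⟨ ∣p∪q∣≤∣p∣+∣q∣ ⁅ vertex b p ⁆ (points b L) ⟩
    ∣ ⁅ vertex b p ⁆ ∣ + ∣ points b L ∣    ≡⟨ cong (_+ ∣ points b L ∣) (∣⁅x⁆∣≡1 (vertex b p)) ⟩
    suc ∣ points b L ∣                     ≤⟨ s≤s (∣points∣≤ b L) ⟩
    suc (length L)                         ∎
    where open ≤-Reasoning

  ∣points∣ : ∀ b {L} → All (_< n) L → Unique L → ∣ points b L ∣ ≡ length L
  ∣points∣ b [] [] = ∣⊥∣≡0 n
  ∣points∣ b {p ∷ L} (p<n ∷ L<n) (p∉L ∷ uniq) = begin
    ∣ ⁅ vertex b p ⁆ ∪ points b L ∣        ≡⟨ ∣p∪q∣≡∣p∣+∣q∣ ⁅ vertex b p ⁆ (points b L) p∉ ⟩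
    ∣ ⁅ vertex b p ⁆ ∣ + ∣ points b L ∣    ≡⟨ cong₂ _+_ (∣⁅x⁆∣≡1 (vertex b p)) (∣points∣ b L<n uniq) ⟩
    suc (length L)                         ∎
    where
      open ≡-Reasoning
      p∉ : ∀ {x} → x ∈ˢ ⁅ vertex b p ⁆ → x ∉ˢ points b L
      p∉ x∈ x∈L rewrite x∈⁅y⁆⇒x≡y _ x∈ = All.lookup p∉L (vertex∈points⇒∈ b L<n p<n x∈L) refl

  ∣sectionSet∣≤ : ∀ i k → ∣ sectionSet i k ∣ ≤ k
  ∣sectionSet∣≤ i k = subst (∣ sectionSet i k ∣ ≤_) (length-upTo k) (∣points∣≤ (toℕ i) (upTo k))

  ∣sectionSet∣ : ∀ i {k} → k ≤ n → ∣ sectionSet i k ∣ ≡ k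
  ∣sectionSet∣ i {k} k≤n = trans
    (∣points∣ (toℕ i) (All.tabulate λ j∈ → <-≤-trans (∈-upTo⁻ j∈) k≤n) (Unique.upTo⁺ k))
    (length-upTo k)

  sectionSet-mono : ∀ i {j k} → j ≤ k → sectionSet i j ⊆ sectionSet i k
  sectionSet-mono i j≤k = points-⊆ (toℕ i) (λ p∈ → ∈-upTo⁺ (<-≤-trans (∈-upTo⁻ p∈) j≤k))

  sectionSet-vertex : ∀ b a k → sectionSet (vertex b a) k ≡ points b (range a k)
  sectionSet-vertex b a k = cong ⋃ (begin
    map (λ j → ⁅ shift (vertex b a) j ⁆) (upTo k)   ≡⟨ map-cong (cong ⁅_⁆ ∘ shift-vertex b a) (upTo k) ⟩
    map (λ j → ⁅ vertex b (a + j) ⁆) (upTo k)       ≡⟨ map-∘ (upTo k) ⟩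
    map (λ p → ⁅ vertex b p ⁆) (range a k)          ∎)
    where open ≡-Reasoning

-- Patterns and their hyperedges

-- A pattern lists sections (a , k) = the offsets a, a+1, …, a+k-1 from a base vertex.
Pattern : Set
Pattern = List (ℕ × ℕ)

offsets : Pattern → List ℕ
offsets [] = []
offsets ((a , k) ∷ P) = range a k ++ offsets P

range⊆offsets : ∀ {P a k p} → (a , k) ∈ P → p ∈ range a k → p ∈ offsets P
range⊆offsets {(a , k) ∷ P} (here refl) p∈ = ∈-++⁺ˡ p∈
range⊆offsets {(a' , k') ∷ P} (there s∈) p∈ = ∈-++⁺ʳ (range a' k') (range⊆offsets s∈ p∈)

Fits : ℕ → Pattern → Set
Fits w P = All (λ s → proj₁ s + proj₂ s ≤ w) P

range<w : ∀ {w a k} → a + k ≤ w → All (_< w) (range a k)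
range<w {a = a} a+k≤w = All.tabulate λ p∈ → case ∈-map⁻ (a +_) p∈ of λ where
  (j , j∈ , refl) → <-≤-trans (+-monoʳ-< a (∈-upTo⁻ j∈)) a+k≤w

offsets<w : ∀ {w P} → Fits w P → All (_< w) (offsets P)
offsets<w [] = []
offsets<w (a+k≤w ∷ fits) = All.++⁺ (range<w a+k≤w) (offsets<w fits)

fits? : ∀ w P → Dec (Fits w P)
fits? w = All.all? (λ s → proj₁ s + proj₂ s ≤? w)

Separated : ℕ × ℕ → ℕ × ℕ → Set
Separated (a , k) (a' , k') = All (_∉ range a' k') (range a k)

Maximal : List ℕ → ℕ × ℕ → Set
Maximal L (a , k) = a + k ∉ L × All (λ p → suc p ≢ a) L

-- Maximal does not look before a section starting at offset 0: that vertex is n ∸ 1, which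
-- Fits 15 keeps out of the pattern as soon as 15 < n.
WellFormed : Pattern → Set
WellFormed P = Fits 15 P × Unique (offsets P) × AllPairs Separated P × All (Maximal (offsets P)) P

wellFormed? : ∀ P → Dec (WellFormed P)
wellFormed? P =
  fits? 15 P ×-dec unique? (offsets P) ×-dec
  AllPairs.allPairs? (λ (a , k) (a' , k') → All.all? (λ p → ¬? (p ∈? range a' k')) (range a k)) P ×-dec
  All.all? (λ s → ¬? (proj₁ s + proj₂ s ∈? offsets P) ×-dec All.all? (λ p → ¬? (suc p ≟ proj₁ s)) (offsets P)) P

NoRun : List ℕ → Set
NoRun L = All (λ p → ¬ All (_∈ L) (range p 5)) L

noRun? : ∀ L → Dec (NoRun L)
noRun? L = All.all? (λ p → ¬? (All.all? (_∈? L) (range p 5))) L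

NoIsolated : List ℕ → Set
NoIsolated L = All (λ p → suc p ∈ L ⊎ Any (λ q → suc q ≡ p) L) L

noIsolated? : ∀ L → Dec (NoIsolated L)
noIsolated? L = All.all? (λ p → (suc p ∈? L) ⊎-dec Any.any? (λ q → suc q ≟ p) L) L

module _ {n : ℕ} .{{_ : NonZero n}} where

  placed : ℕ → Pattern → List (Fin n × ℕ)
  placed b = map (map₁ (vertex b))

  edge : ℕ → Pattern → Subset n
  edge b P = ⋃ (map (λ s → sectionSet (proj₁ s) (proj₂ s)) (placed b P))

  edge-points : ∀ b P → edge b P ≡ points b (offsets P)
  edge-points b [] = refl
  edge-points b ((a , k) ∷ P) = begin
    sectionSet (vertex b a) k ∪ edge b P          ≡⟨ cong₂ _∪_ (sectionSet-vertex b a k) (edge-points b P) ⟩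
    points b (range a k) ∪ points b (offsets P)   ≡⟨ points-++ b (range a k) (offsets P) ⟨
    points b (range a k ++ offsets P)             ∎
    where open ≡-Reasoning

  ∈-edge⁺ : ∀ b P {p} → p ∈ offsets P → vertex b p ∈ˢ edge b P
  ∈-edge⁺ b P p∈ = subst (vertex b _ ∈ˢ_) (sym (edge-points b P)) (∈-points⁺ b p∈)

  ∈-edge⁻ : ∀ b P {x} → x ∈ˢ edge b P → ∃ λ p → p ∈ offsets P × x ≡ vertex b p
  ∈-edge⁻ b P x∈ = ∈-points⁻ b (offsets P) (subst (_ ∈ˢ_) (edge-points b P) x∈)

  vertex∈edge⇒∈ : ∀ b P {p} → All (_< n) (offsets P) → p < n → vertex b p ∈ˢ edge b P → p ∈ offsets P
  vertex∈edge⇒∈ b P P<n p<n v∈ = vertex∈points⇒∈ b P<n p<n (subst (_ ∈ˢ_) (edge-points b P) v∈)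

  ∣edge∣ : ∀ b {P} → All (_< n) (offsets P) → Unique (offsets P) → ∣ edge b P ∣ ≡ length (offsets P)
  ∣edge∣ b {P} P<n uniq = trans (cong ∣_∣ (edge-points b P)) (∣points∣ b P<n uniq)

  points-disjoint : ∀ b {xs ys} → All (_< n) xs → All (_< n) ys → All (_∉ ys) xs → points b xs ∩ points b ys ≡ ∅
  points-disjoint b {xs} {ys} xs<n ys<n xs∉ys = ⊆-antisym meet⊆∅ (⊆-min _)
    where
      meet⊆∅ : points b xs ∩ points b ys ⊆ ∅
      meet⊆∅ x∈ with x∈p∩q⁻ (points b xs) (points b ys) x∈
      ... | x∈xs , x∈ys with ∈-points⁻ b xs x∈xs
      ...   | p , p∈ , refl =
        contradiction (vertex∈points⇒∈ b ys<n (All.lookup xs<n p∈) x∈ys) (All.lookup xs∉ys p∈)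

  module _ (15<n : 15 < n) where

    private
      <15⇒<n : ∀ {p} → p < 15 → p < n
      <15⇒<n p<15 = <-trans p<15 15<n

    edge-section : ∀ b {P a k} → WellFormed P → (a , k) ∈ P → IsSection (edge b P) (vertex b a) k
    edge-section b {P} {a} {k} (fits , _ , _ , maximal) s∈ = inside , before a+k≤15 (All.lookup maximal s∈) , after
      where
        P<n = All.map <15⇒<n (offsets<w fits)
        a+k≤15 = All.lookup fits s∈
        inside : ∀ j → j < k → shift (vertex b a) j ∈ˢ edge b P
        inside j j<k = subst (_∈ˢ edge b P) (sym (shift-vertex b a j))
          (∈-edge⁺ b P (range⊆offsets s∈ (∈-map⁺ (a +_) (∈-upTo⁺ j<k))))
        after : shift (vertex b a) k ∉ˢ edge b P
        after v∈ = proj₁ (All.lookup maximal s∈)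
          (vertex∈edge⇒∈ b P P<n (≤-<-trans a+k≤15 15<n) (subst (_∈ˢ edge b P) (shift-vertex b a k) v∈))
        before : ∀ {a} → a + k ≤ 15 → Maximal (offsets P) (a , k) → pred (vertex b a) ∉ˢ edge b P
        before {zero} _ _ v∈ = <⇒≱ (All.lookup (offsets<w fits) n∸1∈) (∸-monoˡ-≤ 1 15<n)
          where n∸1∈ = vertex∈edge⇒∈ b P P<n (≤-reflexive (suc-pred n))
                        (subst (_∈ˢ edge b P) (shift-vertex b 0 (n ∸ 1)) v∈)
        before {suc a'} a+k≤15 (_ , no-pred) v∈ = All.lookup no-pred a'∈ refl
          where a'∈ = vertex∈edge⇒∈ b P P<n (<15⇒<n (m+n≤o⇒m≤o (suc a') a+k≤15))
                        (subst (_∈ˢ edge b P) (pred-vertex b a') v∈)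
    sectionSets-disjoint : ∀ b {a k a' k'} → a + k ≤ 15 → a' + k' ≤ 15 → Separated (a , k) (a' , k') →
                           Disjoint (sectionSet (vertex b a) k) (sectionSet (vertex b a') k')
    sectionSets-disjoint b {a} {k} {a'} {k'} a+k≤15 a'+k'≤15 sep = begin
      sectionSet (vertex b a) k ∩ sectionSet (vertex b a') k'
        ≡⟨ cong₂ _∩_ (sectionSet-vertex b a k) (sectionSet-vertex b a' k') ⟩
      points b (range a k) ∩ points b (range a' k')
        ≡⟨ points-disjoint b (range<n a+k≤15) (range<n a'+k'≤15) sep ⟩
      ∅ ∎
      where
        open ≡-Reasoning
        range<n : ∀ {a k} → a + k ≤ 15 → All (_< n) (range a k)
        range<n a+k≤15 = All.map <15⇒<n (range<w a+k≤15)

    sections-disjoint : ∀ b {P} → Fits 15 P → AllPairs Separated P →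
      AllPairs (λ s t → Disjoint (sectionSet (proj₁ s) (proj₂ s)) (sectionSet (proj₁ t) (proj₂ t))) (placed b P)
    sections-disjoint b [] [] = []
    sections-disjoint b (fit ∷ fits) (seps ∷ sepss) =
      All.map⁺ (All.zipWith (λ (fit' , sep) → sectionSets-disjoint b fit fit' sep) (fits , seps)) ∷
      sections-disjoint b fits sepss

    section-cards : ∀ b {P} → Fits 15 P → map (λ s → ∣ sectionSet (proj₁ s) (proj₂ s) ∣) (placed b P) ≡ map proj₂ P
    section-cards b [] = refl
    section-cards b {(a , k) ∷ P} (a+k≤15 ∷ fits) = cong₂ _∷_ (∣sectionSet∣ (vertex b a) k≤n) (section-cards b fits)
      where k≤n = ≤-trans (m≤n+m k a) (<⇒≤ (≤-<-trans a+k≤15 15<n))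

    edge-type : ∀ b {P} → WellFormed P → IsTypeHyperedge (map proj₂ P) (edge b P)
    edge-type b {P} wf@(fits , _ , seps , _) =
      placed b P ,
      All.map⁺ (All.tabulate (edge-section b wf)) ,
      sections-disjoint b fits seps ,
      refl ,
      ↭-reflexive (section-cards b fits)

  section-of-size : ∀ {ls e c} → IsTypeHyperedge ls e → c ∈ ls →
    ∃ λ (s : Fin n × ℕ) → IsSection e (proj₁ s) (proj₂ s) × ∣ sectionSet (proj₁ s) (proj₂ s) ∣ ≡ c
  section-of-size (ss , sections , _ , _ , sizes) c∈
    with ∈-map⁻ (λ s → ∣ sectionSet (proj₁ s) (proj₂ s) ∣) (∈-resp-↭ (↭-sym sizes) c∈)
  ... | s , s∈ , c≡ = s , All.lookup sections s∈ , sym c≡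

  type5⇒run : ∀ {e} → IsTypeHyperedge (5 ∷ []) e → ∃ λ i → ∀ j → j < 5 → shift i j ∈ˢ e
  type5⇒run t with section-of-size t (here refl)
  ... | (i , k) , (inside , _ , _) , ∣s∣≡5 =
    i , λ j j<5 → inside j (<-≤-trans j<5 (subst (_≤ k) ∣s∣≡5 (∣sectionSet∣≤ i k)))

  type221⇒isolated : ∀ {e} → 2 ≤ n → IsTypeHyperedge (2 ∷ 2 ∷ 1 ∷ []) e →
                     ∃ λ i → i ∈ˢ e × pred i ∉ˢ e × shift i 1 ∉ˢ e
  type221⇒isolated {e} 2≤n t with section-of-size t (there (there (here refl)))
  ... | (i , k) , (inside , before , after) , ∣s∣≡1 =
    i , subst (_∈ˢ e) (shift-0 i) (inside 0 1≤k) , before , subst (λ k → shift i k ∉ˢ e) k≡1 after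
    where
      1≤k : 1 ≤ k
      1≤k = subst (_≤ k) ∣s∣≡1 (∣sectionSet∣≤ i k)
      k≤1 : k ≤ 1
      k≤1 = ≮⇒≥ λ 2≤k → <⇒≱ (s≤s ≤-refl) (begin
        2                     ≡⟨ ∣sectionSet∣ i 2≤n ⟨
        ∣ sectionSet i 2 ∣    ≤⟨ p⊆q⇒∣p∣≤∣q∣ (sectionSet-mono i 2≤k) ⟩
        ∣ sectionSet i k ∣    ≡⟨ ∣s∣≡1 ⟩
        1                     ∎)
        where open ≤-Reasoning
      k≡1 : k ≡ 1
      k≡1 = ≤-antisym k≤1 1≤k

  edge-no-run : 19 ≤ n → ∀ b {P} → Fits 15 P → NoRun (offsets P) → ¬ IsTypeHyperedge (5 ∷ []) (edge b P)
  edge-no-run 19≤n b {P} fits noRun t with type5⇒run t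
  ... | i , run with ∈-edge⁻ b P (subst (_∈ˢ edge b P) (shift-0 i) (run 0 z<s))
  ...   | p , p∈ , refl = All.lookup noRun p∈ (All.tabulate run⊆offsets)
    where
      P<15 = offsets<w fits
      p+j<n : ∀ {j} → j < 5 → p + j < n
      p+j<n j<5 = <-≤-trans (s≤s (+-mono-≤ (≤-pred (All.lookup P<15 p∈)) (≤-pred j<5))) 19≤n
      run⊆offsets : ∀ {x} → x ∈ range p 5 → x ∈ offsets P
      run⊆offsets x∈ with ∈-map⁻ (p +_) x∈
      ... | j , j∈ , refl =
        vertex∈edge⇒∈ b P (All.map (λ q<15 → <-≤-trans q<15 (m+n≤o⇒n≤o 4 19≤n)) P<15) (p+j<n (∈-upTo⁻ j∈))
                              (subst (_∈ˢ edge b P) (shift-vertex b p j) (run j (∈-upTo⁻ j∈)))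

  edge-no-isolated : 2 ≤ n → ∀ b {P} → NoIsolated (offsets P) → ¬ IsTypeHyperedge (2 ∷ 2 ∷ 1 ∷ []) (edge b P)
  edge-no-isolated 2≤n b {P} noIsolated t with type221⇒isolated 2≤n t
  ... | i , i∈ , before , after with ∈-edge⁻ b P i∈
  ...   | p , p∈ , refl with All.lookup noIsolated p∈
  ...     | inj₁ suc-p∈ = after (subst (_∈ˢ edge b P) (trans (cong (vertex b) (+-comm 1 p)) (sym (shift-vertex b p 1)))
                                (∈-edge⁺ b P suc-p∈))
  ...     | inj₂ precedes with find precedes
  ...       | q , q∈ , refl = before (subst (_∈ˢ edge b P) (sym (pred-vertex b q)) (∈-edge⁺ b P q∈))

-- Meets of hyperedges

module _ {n : ℕ} .{{_ : NonZero n}} where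

  CycleMeet : Subset n → Subset n → Set
  CycleMeet e f = ∣ e ∩ f ∣ ≤ 1 ⊎ IsCycleEdge (e ∩ f)

  cycleMeet? : ∀ e f → Dec (CycleMeet e f)
  cycleMeet? e f = (∣ e ∩ f ∣ ≤? 1) ⊎-dec Fin.any? (λ i → Vec.≡-dec Bool._≟_ (cycleEdge i) (e ∩ f))

  cycleMeet-sym : ∀ {e f} → CycleMeet e f → CycleMeet f e
  cycleMeet-sym {e} {f} = subst (λ s → ∣ s ∣ ≤ 1 ⊎ IsCycleEdge s) (∩-comm e f)

  ∣cycleEdge∣≤2 : ∀ i → ∣ cycleEdge i ∣ ≤ 2
  ∣cycleEdge∣≤2 i = subst (∣ cycleEdge i ∣ ≤_) (cong₂ _+_ (∣⁅x⁆∣≡1 i) (∣⁅x⁆∣≡1 (shift i 1)))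
                      (∣p∪q∣≤∣p∣+∣q∣ ⁅ i ⁆ ⁅ shift i 1 ⁆)

  ∣cycleEdge∣ : 2 ≤ n → ∀ i → ∣ cycleEdge i ∣ ≡ 2
  ∣cycleEdge∣ 2≤n i = trans (∣p∪q∣≡∣p∣+∣q∣ ⁅ i ⁆ ⁅ shift i 1 ⁆ i∉) (cong₂ _+_ (∣⁅x⁆∣≡1 i) (∣⁅x⁆∣≡1 (shift i 1)))
    where
      i≢i+1 : i ≢ shift i 1
      i≢i+1 eq with vertex-injective (toℕ i) (≤-trans (s≤s z≤n) 2≤n) 2≤n (trans (shift-0 i) eq)
      ... | ()
      i∉ : ∀ {x} → x ∈ˢ ⁅ i ⁆ → x ∉ˢ ⁅ shift i 1 ⁆
      i∉ x∈ x∈′ = i≢i+1 (trans (sym (x∈⁅y⁆⇒x≡y i x∈)) (x∈⁅y⁆⇒x≡y _ x∈′))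

  cycleMeet⇒≤2 : ∀ {e f} → CycleMeet e f → ∣ e ∩ f ∣ ≤ 2
  cycleMeet⇒≤2 (inj₁ ≤1) = m≤n⇒m≤1+n ≤1
  cycleMeet⇒≤2 (inj₂ (i , eq)) = subst (λ s → ∣ s ∣ ≤ 2) eq (∣cycleEdge∣≤2 i)

  cycleMeet⇒≢ : ∀ {e f} → 2 < ∣ e ∣ → CycleMeet e f → e ≢ f
  cycleMeet⇒≢ {e} 2<∣e∣ meet refl = <⇒≱ 2<∣e∣ (subst (λ s → ∣ s ∣ ≤ 2) (∩-idem e) (cycleMeet⇒≤2 meet))

  cycleMeet⇒cycleEdge : ∀ {e f} → CycleMeet e f → 2 ≤ ∣ e ∩ f ∣ → IsCycleEdge (e ∩ f)
  cycleMeet⇒cycleEdge (inj₁ ≤1) 2≤ = contradiction (≤-trans 2≤ ≤1) λ { (s≤s ()) }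
  cycleMeet⇒cycleEdge (inj₂ c) _ = c

  Covers : List (Subset n) → Set
  Covers es = ∀ i → Any (λ e → Any (λ f → e ∩ f ≡ cycleEdge i) es) es

  covers? : ∀ es → Dec (Covers es)
  covers? es = Fin.all? λ i → Any.any? (λ e → Any.any? (λ f → Vec.≡-dec Bool._≟_ (e ∩ f) (cycleEdge i)) es) es

AllPairs-lookup : ∀ {A : Set} {R : A → A → Set} {xs x y} → AllPairs R xs → x ∈ xs → y ∈ xs → x ≢ y → R x y ⊎ R y x
AllPairs-lookup (_ ∷ _) (here refl) (here refl) x≢y = contradiction refl x≢y
AllPairs-lookup (Rx ∷ _) (here refl) (there y∈) _ = inj₁ (All.lookup Rx y∈)
AllPairs-lookup (Rx ∷ _) (there x∈) (here refl) _ = inj₂ (All.lookup Rx x∈)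
AllPairs-lookup (_ ∷ Rxs) (there x∈) (there y∈) x≢y = AllPairs-lookup Rxs x∈ y∈ x≢y

module CycleMeets {n : ℕ} .{{_ : NonZero n}} (es : List (Subset n))
                  (large : All (λ e → 2 < ∣ e ∣) es) (meets : AllPairs CycleMeet es) where

  distinct : AllPairs _≢_ es
  distinct = go large meets
    where
      go : ∀ {xs} → All (λ e → 2 < ∣ e ∣) xs → AllPairs CycleMeet xs → AllPairs _≢_ xs
      go [] [] = []
      go (2<∣e∣ ∷ large) (meet ∷ meets) = All.map (cycleMeet⇒≢ 2<∣e∣) meet ∷ go large meets

  hypergraph : Hypergraph n
  hypergraph = record { edges = es ; unique = distinct }

  EI⇒cycleEdge : ∀ s → IsEIEdge hypergraph s → IsCycleEdge s
  EI⇒cycleEdge s (e , f , e∈ , f∈ , e≢f , 2≤∣s∣ , refl) =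
    cycleMeet⇒cycleEdge ([ id , cycleMeet-sym ] (AllPairs-lookup meets e∈ f∈ e≢f)) 2≤∣s∣

  cycleEdge⇒EI : 2 ≤ n → Covers es → ∀ s → IsCycleEdge s → IsEIEdge hypergraph s
  cycleEdge⇒EI 2≤n covers s (i , refl) with find (covers i)
  ... | e , e∈ , f-any with find f-any
  ...   | f , f∈ , e∩f≡ = e , f , e∈ , f∈ , e≢f , ≤-reflexive (sym ∣e∩f∣≡2) , e∩f≡
    where
      ∣e∩f∣≡2 : ∣ e ∩ f ∣ ≡ 2
      ∣e∩f∣≡2 = trans (cong ∣_∣ e∩f≡) (∣cycleEdge∣ 2≤n i)
      e≢f : e ≢ f
      e≢f refl = <⇒≢ (All.lookup large e∈) (sym (trans (cong ∣_∣ (sym (∩-idem e))) ∣e∩f∣≡2))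

  EIisCycle-hypergraph : 2 ≤ n → Covers es → EIisCycle hypergraph
  EIisCycle-hypergraph 2≤n covers = EI⇒cycleEdge , cycleEdge⇒EI 2≤n covers

common : ℕ → Pattern → Pattern → List ℕ
common d P Q = filter (_∈? map (d +_) (offsets Q)) (offsets P)

data AtMostAnEdge : List ℕ → Set where
  short    : ∀ {L} → length L ≤ 1 → AtMostAnEdge L
  adjacent : ∀ c → AtMostAnEdge (c ∷ suc c ∷ [])

atMostAnEdge? : ∀ L → Dec (AtMostAnEdge L)
atMostAnEdge? [] = yes (short z≤n)
atMostAnEdge? (c ∷ []) = yes (short (s≤s z≤n))
atMostAnEdge? (c ∷ c′ ∷ []) with c′ ≟ suc c
... | yes refl = yes (adjacent c)
... | no c′≢1+c = no λ { (short (s≤s ())) ; (adjacent _) → c′≢1+c refl }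
atMostAnEdge? (_ ∷ _ ∷ _ ∷ _) = no λ { (short (s≤s ())) }

-- When b₂ ≡ b₁ + d (mod n), the meet of edge b₁ P and edge b₂ Q is read off the offsets of P
-- and the offsets of Q shifted by d, provided all of them stay below some w ≤ n (edge∩edge).
record LocalCheck (w d : ℕ) (P Q : Pattern) : Set where
  constructor localCheck
  field
    P<w   : All (_< w) (offsets P)
    dQ<w  : All (λ q → d + q < w) (offsets Q)
    shape : AtMostAnEdge (common d P Q)

localCheck? : ∀ w d P Q → Dec (LocalCheck w d P Q)
localCheck? w d P Q =
  map′ (λ (P<w , dQ<w , shape) → localCheck P<w dQ<w shape) (λ (localCheck P<w dQ<w shape) → P<w , dQ<w , shape)
  (All.all? (_<? w) (offsets P) ×-dec All.all? (λ q → d + q <? w) (offsets Q) ×-dec atMostAnEdge? (common d P Q))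

module _ {n : ℕ} .{{_ : NonZero n}} where

  edge∩edge : ∀ b₁ b₂ d P Q → (b₁ + d) % n ≡ b₂ % n →
              All (_< n) (offsets P) → All (λ q → d + q < n) (offsets Q) →
              edge b₁ P ∩ edge b₂ Q ≡ points b₁ (common d P Q)
  edge∩edge b₁ b₂ d P Q rel P<n Q<n = ⊆-antisym meet⊆ ⊆meet
    where
      dQ = map (d +_) (offsets Q)
      meet⊆ : edge b₁ P ∩ edge b₂ Q ⊆ points b₁ (common d P Q)
      meet⊆ x∈ with x∈p∩q⁻ (edge b₁ P) (edge b₂ Q) x∈
      ... | x∈P , x∈Q with ∈-edge⁻ b₁ P x∈P | ∈-edge⁻ b₂ Q x∈Q
      ...   | p , p∈ , refl | q , q∈ , eq = ∈-points⁺ b₁ (∈-filter⁺ (_∈? dQ) p∈ p∈dQ)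
        where
          p≡d+q : p ≡ d + q
          p≡d+q = vertex-injective b₁ (All.lookup P<n p∈) (All.lookup Q<n q∈)
                    (trans eq (vertex-rebase b₁ b₂ d q rel))
          p∈dQ : p ∈ dQ
          p∈dQ = subst (_∈ dQ) (sym p≡d+q) (∈-map⁺ (d +_) q∈)
      ⊆meet : points b₁ (common d P Q) ⊆ edge b₁ P ∩ edge b₂ Q
      ⊆meet x∈ with ∈-points⁻ b₁ (common d P Q) x∈
      ... | r , r∈ , refl with ∈-filter⁻ (_∈? dQ) {xs = offsets P} r∈
      ...   | r∈P , r∈dQ with ∈-map⁻ (d +_) r∈dQ
      ...     | q , q∈ , refl =
        x∈p∩q⁺ (∈-edge⁺ b₁ P r∈P , subst (_∈ˢ edge b₂ Q) (vertex-rebase b₁ b₂ d q rel) (∈-edge⁺ b₂ Q q∈))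

  points-adjacent : ∀ b c → points b (c ∷ suc c ∷ []) ≡ cycleEdge (vertex b c)
  points-adjacent b c = begin
    ⁅ vertex b c ⁆ ∪ (⁅ vertex b (suc c) ⁆ ∪ ∅)   ≡⟨ cong (⁅ vertex b c ⁆ ∪_) (∪-identityʳ _) ⟩
    ⁅ vertex b c ⁆ ∪ ⁅ vertex b (suc c) ⁆         ≡⟨ cong (λ v → ⁅ vertex b c ⁆ ∪ ⁅ v ⁆) next ⟩
    ⁅ vertex b c ⁆ ∪ ⁅ shift (vertex b c) 1 ⁆     ∎
    where
      open ≡-Reasoning
      next : vertex b (suc c) ≡ shift (vertex b c) 1
      next = trans (cong (vertex b) (+-comm 1 c)) (sym (shift-vertex b c 1))

  local-meet : ∀ {w b₁ b₂ d P Q} → w ≤ n → (b₁ + d) % n ≡ b₂ % n → LocalCheck w d P Q →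
               CycleMeet (edge b₁ P) (edge b₂ Q)
  local-meet {w} {b₁} {b₂} {d} {P} {Q} w≤n rel (localCheck P<w Q<w shape) =
    subst (λ s → ∣ s ∣ ≤ 1 ⊎ IsCycleEdge s) (sym (edge∩edge b₁ b₂ d P Q rel P<n Q<n)) (points-meet shape)
    where
      P<n = All.map (λ p<w → <-≤-trans p<w w≤n) P<w
      Q<n = All.map (λ q<w → <-≤-trans q<w w≤n) Q<w
      points-meet : ∀ {L} → AtMostAnEdge L → ∣ points b₁ L ∣ ≤ 1 ⊎ IsCycleEdge (points b₁ L)
      points-meet {L} (short ≤1) = inj₁ (≤-trans (∣points∣≤ b₁ L) ≤1)
      points-meet (adjacent c) = inj₂ (vertex b₁ c , sym (points-adjacent b₁ c))

  local-meet-edge : ∀ {w b₁ b₂ d P Q c} → w ≤ n → (b₁ + d) % n ≡ b₂ % n → LocalCheck w d P Q →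
                    common d P Q ≡ c ∷ suc c ∷ [] → edge b₁ P ∩ edge b₂ Q ≡ cycleEdge (vertex b₁ c)
  local-meet-edge {w} {b₁} {b₂} {d} {P} {Q} {c} w≤n rel (localCheck P<w Q<w _) common≡ = begin
    edge b₁ P ∩ edge b₂ Q           ≡⟨ edge∩edge b₁ b₂ d P Q rel P<n Q<n ⟩
    points b₁ (common d P Q)        ≡⟨ cong (points b₁) common≡ ⟩
    points b₁ (c ∷ suc c ∷ [])      ≡⟨ points-adjacent b₁ c ⟩
    cycleEdge (vertex b₁ c)         ∎
    where
      open ≡-Reasoning
      P<n = All.map (λ p<w → <-≤-trans p<w w≤n) P<w
      Q<n = All.map (λ q<w → <-≤-trans q<w w≤n) Q<w

  -- Read from b₁, P lies below w₁ ≤ d and Q lies in d, …, d + w₂ - 1 without wrapping around.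
  far-meet : ∀ {w₁ w₂ b₁ b₂ d P Q} → (b₁ + d) % n ≡ b₂ % n → Fits w₁ P → Fits w₂ Q → w₁ ≤ d → d + w₂ ≤ n →
             CycleMeet (edge b₁ P) (edge b₂ Q)
  far-meet {w₁} {w₂} {b₁} {b₂} {d} {P} {Q} rel fitsP fitsQ w₁≤d d+w₂≤n =
    inj₁ (m≤n⇒m≤1+n (≤-trans (p⊆q⇒∣p∣≤∣q∣ {q = ∅} meet⊆∅) (≤-reflexive (∣⊥∣≡0 n))))
    where
      meet⊆∅ : edge b₁ P ∩ edge b₂ Q ⊆ ∅
      meet⊆∅ x∈ with x∈p∩q⁻ (edge b₁ P) (edge b₂ Q) x∈
      ... | x∈P , x∈Q with ∈-edge⁻ b₁ P x∈P | ∈-edge⁻ b₂ Q x∈Q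
      ...   | p , p∈ , refl | q , q∈ , eq = contradiction (≤-trans w₁≤d (m≤m+n d q)) (<⇒≱ (subst (_< w₁) p≡d+q p<w₁))
        where
          p<w₁ = All.lookup (offsets<w fitsP) p∈
          d+q<n = <-≤-trans (+-monoʳ-< d (All.lookup (offsets<w fitsQ) q∈)) d+w₂≤n
          p≡d+q = vertex-injective b₁ (<-≤-trans p<w₁ (≤-trans w₁≤d (≤-trans (m≤m+n d w₂) d+w₂≤n))) d+q<n
                    (trans eq (vertex-rebase b₁ b₂ d q rel))

-- The construction

X Y P₁ P₂₂₁ P₃ P₄ P₅ : Pattern
X = (0 , 3) ∷ (8 , 2) ∷ []
Y = (1 , 3) ∷ (6 , 2) ∷ []
P₁ = (1 , 3) ∷ (8 , 2) ∷ []
P₂₂₁ = (7 , 2) ∷ (11 , 2) ∷ (4 , 1) ∷ []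
P₃ = (6 , 3) ∷ (13 , 2) ∷ []
P₄ = (10 , 3) ∷ (5 , 2) ∷ []
P₅ = (2 , 5) ∷ []

patches : List Pattern
patches = P₁ ∷ P₂₂₁ ∷ P₃ ∷ P₄ ∷ P₅ ∷ []

P₁∈ : P₁ ∈ patches
P₁∈ = here refl

P₂₂₁∈ : P₂₂₁ ∈ patches
P₂₂₁∈ = there (here refl)

P₃∈ : P₃ ∈ patches
P₃∈ = there (there (here refl))

P₄∈ : P₄ ∈ patches
P₄∈ = there (there (there (here refl)))

P₅∈ : P₅ ∈ patches
P₅∈ = there (there (there (there (here refl))))

module _ {n : ℕ} .{{_ : NonZero n}} where

  rowEdges : Pattern → ℕ → List (Subset n)
  rowEdges P K = applyUpTo (λ j → edge (3 * j) P) K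

  patchEdges : List (Subset n)
  patchEdges = map (edge (n ∸ 8)) patches

  construction : ℕ → List (Subset n)
  construction K = rowEdges X K ++ rowEdges Y K ++ patchEdges

  length-construction : ∀ K → length (construction K) ≡ K + (K + 5)
  length-construction K = begin
    length (rowEdges X K ++ rowEdges Y K ++ patchEdges)
      ≡⟨ length-++ (rowEdges X K) ⟩
    length (rowEdges X K) + length (rowEdges Y K ++ patchEdges)
      ≡⟨ cong (length (rowEdges X K) +_) (length-++ (rowEdges Y K)) ⟩
    length (rowEdges X K) + (length (rowEdges Y K) + 5)
      ≡⟨ cong₂ (λ x y → x + (y + 5)) (length-applyUpTo _ K) (length-applyUpTo _ K) ⟩
    K + (K + 5) ∎
    where open ≡-Reasoning

  row∈ : ∀ {P K j} → j < K → edge (3 * j) P ∈ rowEdges P K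
  row∈ {P} j<K = ∈-applyUpTo⁺ (λ j → edge (3 * j) P) j<K

  X∈ : ∀ {K j} → j < K → edge (3 * j) X ∈ construction K
  X∈ {K} j<K = ∈-++⁺ˡ (row∈ {P = X} {K = K} j<K)

  Y∈ : ∀ {K j} → j < K → edge (3 * j) Y ∈ construction K
  Y∈ {K} j<K = ∈-++⁺ʳ (rowEdges X K) (∈-++⁺ˡ (row∈ {P = Y} {K = K} j<K))

  patch∈ : ∀ K {P} → P ∈ patches → edge (n ∸ 8) P ∈ construction K
  patch∈ K P∈ = ∈-++⁺ʳ (rowEdges X K) (∈-++⁺ʳ (rowEdges Y K) (∈-map⁺ (edge (n ∸ 8)) P∈))

  all-construction : ∀ {Q : Subset n → Set} K → (∀ j → Q (edge (3 * j) X)) → (∀ j → Q (edge (3 * j) Y)) →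
                     All (λ P → Q (edge (n ∸ 8) P)) patches → All Q (construction K)
  all-construction K QX QY Qpatches =
    All.++⁺ (All.applyUpTo⁺₂ _ K QX) (All.++⁺ (All.applyUpTo⁺₂ _ K QY) (All.map⁺ Qpatches))

  module _ (19≤n : 19 ≤ n) where

    private
      15<n : 15 < n
      15<n = m+n≤o⇒n≤o 3 19≤n

    card : ∀ {b} P {_ : True (wellFormed? P)} {_ : True (length (offsets P) ≟ 5)} → ∣ edge b P ∣ ≡ 5
    card {b} P {wf} {len} with toWitness wf
    ... | fits , uniq , _ =
      trans (∣edge∣ b {P} (All.map (λ p<15 → <-trans p<15 15<n) (offsets<w fits)) uniq) (toWitness len)

    typed : ∀ {b} P {_ : True (wellFormed? P)} → IsTypeHyperedge (map proj₂ P) (edge b P)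
    typed {b} P {wf} = edge-type 15<n b {P} (toWitness wf)

    no-run : ∀ {b} P {_ : True (wellFormed? P)} {_ : True (noRun? (offsets P))} → ¬ IsTypeHyperedge (5 ∷ []) (edge b P)
    no-run {b} P {wf} {nr} = edge-no-run 19≤n b {P} (proj₁ (toWitness wf)) (toWitness nr)

    no-isolated : ∀ {b} P {_ : True (noIsolated? (offsets P))} → ¬ IsTypeHyperedge (2 ∷ 2 ∷ 1 ∷ []) (edge b P)
    no-isolated {b} P {ni} = edge-no-isolated (m+n≤o⇒n≤o 17 19≤n) b {P} (toWitness ni)

    module Types (K : ℕ) where

      e₅ e₂₂₁ : Subset n
      e₅ = edge (n ∸ 8) P₅
      e₂₂₁ = edge (n ∸ 8) P₂₂₁

      uniform : All (λ e → ∣ e ∣ ≡ 5) (construction K)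
      uniform = all-construction K (λ _ → card X) (λ _ → card Y)
        (card P₁ ∷ card P₂₂₁ ∷ card P₃ ∷ card P₄ ∷ card P₅ ∷ [])

      large : All (λ e → 2 < ∣ e ∣) (construction K)
      large = All.map (λ ∣e∣≡5 → subst (2 <_) (sym ∣e∣≡5) (s≤s (s≤s (s≤s z≤n)))) uniform

      only-e₅ : All (λ e → IsTypeHyperedge (5 ∷ []) e → e ≡ e₅) (construction K)
      only-e₅ = all-construction K (λ _ → ⊥-elim ∘ no-run X) (λ _ → ⊥-elim ∘ no-run Y)
        ((⊥-elim ∘ no-run P₁) ∷ (⊥-elim ∘ no-run P₂₂₁) ∷ (⊥-elim ∘ no-run P₃) ∷ (⊥-elim ∘ no-run P₄) ∷
         (λ _ → refl) ∷ [])

      only-e₂₂₁ : All (λ e → IsTypeHyperedge (2 ∷ 2 ∷ 1 ∷ []) e → e ≡ e₂₂₁) (construction K)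
      only-e₂₂₁ = all-construction K (λ _ → ⊥-elim ∘ no-isolated X) (λ _ → ⊥-elim ∘ no-isolated Y)
        ((⊥-elim ∘ no-isolated P₁) ∷ (λ _ → refl) ∷ (⊥-elim ∘ no-isolated P₃) ∷ (⊥-elim ∘ no-isolated P₄) ∷
         (⊥-elim ∘ no-isolated P₅) ∷ [])

      others-32 : All (λ e → e ≢ e₅ → e ≢ e₂₂₁ → IsTypeHyperedge (3 ∷ 2 ∷ []) e) (construction K)
      others-32 = all-construction K (λ _ _ _ → typed X) (λ _ _ _ → typed Y)
        ((λ _ _ → typed P₁) ∷ (λ _ ≢e₂₂₁ → contradiction refl ≢e₂₂₁) ∷ (λ _ _ → typed P₃) ∷ (λ _ _ → typed P₄) ∷
         (λ ≢e₅ _ → contradiction refl ≢e₅) ∷ [])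

-- The case n ≥ 25

RowChecks : Pattern → Pattern → Set
RowChecks P Q = All (λ δ → LocalCheck 25 (3 * δ) P Q) (1 ∷ 2 ∷ 3 ∷ [])

rowChecks? : ∀ P Q → Dec (RowChecks P Q)
rowChecks? P Q = All.all? (λ δ → localCheck? 25 (3 * δ) P Q) (1 ∷ 2 ∷ 3 ∷ [])

PatchRowChecks : Pattern → Pattern → Set
PatchRowChecks P Q = All (λ j → LocalCheck 25 (8 + 3 * j) P Q) (0 ∷ 1 ∷ 2 ∷ []) ×
                     All (λ t → LocalCheck 25 (2 + 3 * t) Q P) (0 ∷ 1 ∷ 2 ∷ [])

patchRowChecks? : ∀ P Q → Dec (PatchRowChecks P Q)
patchRowChecks? P Q = All.all? (λ j → localCheck? 25 (8 + 3 * j) P Q) (0 ∷ 1 ∷ 2 ∷ []) ×-dec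
                      All.all? (λ t → localCheck? 25 (2 + 3 * t) Q P) (0 ∷ 1 ∷ 2 ∷ [])

module General {n : ℕ} .{{_ : NonZero n}} (m : ℕ) (n≡3m+1 : n ≡ 3 * m + 1) (8≤m : 8 ≤ m) where

  K : ℕ
  K = m ∸ 2

  25≤n : 25 ≤ n
  25≤n = subst (25 ≤_) (sym n≡3m+1) (+-monoˡ-≤ 1 (*-monoʳ-≤ 3 8≤m))

  <K⇒+3≤m : ∀ {k} → k < K → k + 3 ≤ m
  <K⇒+3≤m {k} k<K = subst (_≤ m) (sym (+-suc k 2)) (m≤o∸n⇒m+n≤o (suc k) (≤-trans (s≤s (s≤s z≤n)) 8≤m) k<K)

  3k+10≤n : ∀ {k} → k + 3 ≤ m → 3 * k + 10 ≤ n
  3k+10≤n {k} k+3≤m = begin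
    3 * k + 10         ≡⟨ lemma k ⟩
    3 * (k + 3) + 1    ≤⟨ +-monoˡ-≤ 1 (*-monoʳ-≤ 3 k+3≤m) ⟩
    3 * m + 1          ≡⟨ n≡3m+1 ⟨
    n                  ∎
    where
      open ≤-Reasoning
      lemma : ∀ k → 3 * k + 10 ≡ 3 * (k + 3) + 1
      lemma = solve-∀

  same-base : ∀ b → (b + 0) % n ≡ b % n
  same-base b = cong (_% n) (+-identityʳ b)

  step : ∀ j d → (3 * j + 3 * d) % n ≡ (3 * (j + d)) % n
  step j d = cong (_% n) (sym (*-distribˡ-+ 3 j d))

  n∸8+8≡n : n ∸ 8 + 8 ≡ n
  n∸8+8≡n = m∸n+n≡m (≤-trans (m≤m+n 8 17) 25≤n)

  wrap : ∀ x → (n ∸ 8 + (8 + x)) % n ≡ x % n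
  wrap x = begin
    (n ∸ 8 + (8 + x)) % n   ≡⟨ cong (_% n) (+-assoc (n ∸ 8) 8 x) ⟨
    (n ∸ 8 + 8 + x) % n     ≡⟨ cong (λ y → (y + x) % n) n∸8+8≡n ⟩
    (n + x) % n             ≡⟨ cong (_% n) (+-comm n x) ⟩
    (x + n) % n             ≡⟨ [m+n]%n≡m%n x n ⟩
    x % n                   ∎
    where open ≡-Reasoning

  toward-end : ∀ j t → j + 3 + t ≡ m → (3 * j + (2 + 3 * t)) % n ≡ (n ∸ 8) % n
  toward-end j t j+3+t≡m = cong (_% n) (sym (begin
    n ∸ 8                               ≡⟨ cong (_∸ 8) n≡3m+1 ⟩
    3 * m + 1 ∸ 8                       ≡⟨ cong (λ m → 3 * m + 1 ∸ 8) j+3+t≡m ⟨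
    3 * (j + 3 + t) + 1 ∸ 8             ≡⟨ cong (_∸ 8) (lemma j t) ⟩
    3 * j + (2 + 3 * t) + 8 ∸ 8         ≡⟨ m+n∸n≡m _ 8 ⟩
    3 * j + (2 + 3 * t)                 ∎))
    where
      open ≡-Reasoning
      lemma : ∀ j t → 3 * (j + 3 + t) + 1 ≡ 3 * j + (2 + 3 * t) + 8
      lemma = solve-∀

  rows-meet : ∀ {P Q} → Fits 10 P → Fits 10 Q → RowChecks P Q →
              ∀ {j k} → j < k → k < K → CycleMeet (edge (3 * j) P) (edge (3 * k) Q)
  rows-meet {P} {Q} fitsP fitsQ (c₁ ∷ c₂ ∷ c₃ ∷ []) {j} {k} j<k k<K =
    subst (λ k → CycleMeet (edge (3 * j) P) (edge (3 * k) Q)) j+gap≡k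
      (by-gap (k ∸ suc j) (subst (_< K) (sym j+gap≡k) k<K))
    where
      j+gap≡k = trans (+-suc j _) (m+[n∸m]≡n j<k)
      by-gap : ∀ δ → j + suc δ < K → CycleMeet (edge (3 * j) P) (edge (3 * (j + suc δ)) Q)
      by-gap 0 _ = local-meet 25≤n (step j 1) c₁
      by-gap 1 _ = local-meet 25≤n (step j 2) c₂
      by-gap 2 _ = local-meet 25≤n (step j 3) c₃
      by-gap δ@(suc (suc (suc _))) k<K = far-meet (step j (suc δ)) fitsP fitsQ
        (≤-trans (m≤n+m 10 2) (*-monoʳ-≤ 3 (s≤s (s≤s (s≤s (s≤s z≤n))))))
        (≤-trans (+-monoˡ-≤ 10 (*-monoʳ-≤ 3 (m≤n+m (suc δ) j))) (3k+10≤n (<K⇒+3≤m k<K)))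

  cross-meet : ∀ {P Q} → Fits 10 P → Fits 10 Q → LocalCheck 25 0 P Q → RowChecks P Q → RowChecks Q P →
               ∀ {j k} → j < K → k < K → CycleMeet (edge (3 * j) P) (edge (3 * k) Q)
  cross-meet fitsP fitsQ check₀ checksPQ checksQP {j} {k} j<K k<K with <-cmp j k
  ... | tri< j<k _ _ = rows-meet fitsP fitsQ checksPQ j<k k<K
  ... | tri≈ _ refl _ = local-meet 25≤n (same-base (3 * j)) check₀
  ... | tri> _ _ k<j = cycleMeet-sym (rows-meet fitsQ fitsP checksQP k<j j<K)

  patch-row-meet : ∀ {P Q} → Fits 15 P → Fits 10 Q → PatchRowChecks P Q →
                   ∀ {j} → j < K → CycleMeet (edge (n ∸ 8) P) (edge (3 * j) Q)
  patch-row-meet _ _ (c₀ ∷ _ , _) {0} _ = local-meet 25≤n (wrap 0) c₀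
  patch-row-meet _ _ (_ ∷ c₁ ∷ _ , _) {1} _ = local-meet 25≤n (wrap 3) c₁
  patch-row-meet _ _ (_ ∷ _ ∷ c₂ ∷ [] , _) {2} _ = local-meet 25≤n (wrap 6) c₂
  patch-row-meet {P} {Q} fitsP fitsQ (_ , c₀ ∷ c₁ ∷ c₂ ∷ []) {j@(suc (suc (suc _)))} j<K =
    by-distance-to-end (m ∸ (j + 3)) (m+[n∸m]≡n (<K⇒+3≤m j<K))
    where
      by-distance-to-end : ∀ t → j + 3 + t ≡ m → CycleMeet (edge (n ∸ 8) P) (edge (3 * j) Q)
      by-distance-to-end 0 eq = cycleMeet-sym (local-meet 25≤n (toward-end j 0 eq) c₀)
      by-distance-to-end 1 eq = cycleMeet-sym (local-meet 25≤n (toward-end j 1 eq) c₁)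
      by-distance-to-end 2 eq = cycleMeet-sym (local-meet 25≤n (toward-end j 2 eq) c₂)
      by-distance-to-end t@(suc (suc (suc _))) eq = far-meet (wrap (3 * j)) fitsP fitsQ
        (≤-trans (m≤m+n 15 2) (+-monoʳ-≤ 8 (*-monoʳ-≤ 3 (s≤s (s≤s (s≤s z≤n))))))
        (begin
          8 + 3 * j + 10   ≡⟨ lemma j ⟩
          3 * (j + 6)      ≤⟨ *-monoʳ-≤ 3 (+-monoʳ-≤ j (+-monoʳ-≤ 3 (s≤s (s≤s (s≤s z≤n))))) ⟩
          3 * (j + (3 + t)) ≡⟨ cong (3 *_) (trans (sym (+-assoc j 3 t)) eq) ⟩
          3 * m            ≤⟨ m≤m+n (3 * m) 1 ⟩
          3 * m + 1        ≡⟨ n≡3m+1 ⟨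
          n                ∎)
        where
          open ≤-Reasoning
          lemma : ∀ j → 8 + 3 * j + 10 ≡ 3 * (j + 6)
          lemma = solve-∀

  row-vs-patches : ∀ {Q} → Fits 10 Q → All (λ P → Fits 15 P × PatchRowChecks P Q) patches →
                   ∀ {j} → j < K → All (CycleMeet (edge (3 * j) Q)) patchEdges
  row-vs-patches fitsQ facts j<K =
    All.map⁺ (All.map (λ (fitsP , checks) → cycleMeet-sym (patch-row-meet fitsP fitsQ checks j<K)) facts)

  rows-meets : ∀ {P} → Fits 10 P → RowChecks P P → AllPairs CycleMeet (rowEdges P K)
  rows-meets fits checks = AllPairs.applyUpTo⁺₁ _ K (rows-meet fits fits checks)

  meets : AllPairs CycleMeet (construction K)
  meets = AllPairs.++⁺ (rows-meets fitsX (from-yes (rowChecks? X X)))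
    (AllPairs.++⁺ (rows-meets fitsY (from-yes (rowChecks? Y Y))) patch-meets
       (All.applyUpTo⁺₁ _ K (row-vs-patches fitsY patch-facts-Y)))
    (All.applyUpTo⁺₁ _ K λ j<K →
       All.++⁺ (All.applyUpTo⁺₁ _ K (cross-meet fitsX fitsY (from-yes (localCheck? 25 0 X Y))
                                        (from-yes (rowChecks? X Y)) (from-yes (rowChecks? Y X)) j<K))
               (row-vs-patches fitsX patch-facts-X j<K))
    where
      fitsX = from-yes (fits? 10 X)
      fitsY = from-yes (fits? 10 Y)
      patch-facts-X = from-yes (All.all? (λ P → fits? 15 P ×-dec patchRowChecks? P X) patches)
      patch-facts-Y = from-yes (All.all? (λ P → fits? 15 P ×-dec patchRowChecks? P Y) patches)
      patch-meets : AllPairs CycleMeet patchEdges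
      patch-meets = AllPairs.map⁺ (AllPairs.map (local-meet 25≤n (same-base (n ∸ 8)))
                                     (from-yes (AllPairs.allPairs? (localCheck? 25 0) patches)))

  H : List (Subset n)
  H = construction K

  Covered : Fin n → Set
  Covered i = Any (λ e → Any (λ f → e ∩ f ≡ cycleEdge i) H) H

  covered-by : ∀ b₁ P b₂ Q d {c i} {checked : True (localCheck? 25 d P Q)} → edge b₁ P ∈ H → edge b₂ Q ∈ H →
               (b₁ + d) % n ≡ b₂ % n → common d P Q ≡ c ∷ suc c ∷ [] → vertex b₁ c ≡ i → Covered i
  covered-by b₁ P b₂ Q d {checked = checked} e∈ f∈ rel common≡ v≡i =
    lose e∈ (lose f∈ (trans (local-meet-edge 25≤n rel (toWitness checked) common≡) (cong cycleEdge v≡i)))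

  vertex-at : ∀ b c (i : Fin n) → (b + c) % n ≡ toℕ i → vertex b c ≡ i
  vertex-at b c i eq = Fin.toℕ-injective (trans (toℕ-mod _) eq)

  low-vertex : ∀ b c (i : Fin n) → toℕ i ≡ b + c → vertex b c ≡ i
  low-vertex b c i eq = vertex-at b c i (trans (m<n⇒m%n≡m (subst (_< n) eq (Fin.toℕ<n i))) (sym eq))

  start-vertex : ∀ (i : Fin n) {v} → toℕ i ≡ v → vertex (n ∸ 8) (8 + v) ≡ i
  start-vertex i refl = vertex-at (n ∸ 8) (8 + toℕ i) i (trans (wrap (toℕ i)) (m<n⇒m%n≡m (Fin.toℕ<n i)))

  0<K : 0 < K
  0<K = ≤-trans (s≤s z≤n) (m+n≤o⇒m≤o∸n 1 (≤-trans (s≤s (s≤s (s≤s z≤n))) 8≤m))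

  1<K : 1 < K
  1<K = m+n≤o⇒m≤o∸n 2 (≤-trans (s≤s (s≤s (s≤s (s≤s z≤n)))) 8≤m)

  cover-start : ∀ i {v} → toℕ i ≡ v → v < 6 → Covered i
  cover-start i {0} v≡ _ =
    covered-by (n ∸ 8) P₁ 0 X 8 (patch∈ K P₁∈) (X∈ 0<K) (wrap 0) refl (start-vertex i v≡)
  cover-start i {1} v≡ _ =
    covered-by 0 X 0 Y 0 (X∈ 0<K) (Y∈ 0<K) refl refl (low-vertex 0 1 i v≡)
  cover-start i {2} v≡ _ =
    covered-by (n ∸ 8) P₄ 0 Y 8 (patch∈ K P₄∈) (Y∈ 0<K) (wrap 0) refl (start-vertex i v≡)
  cover-start i {3} v≡ _ =
    covered-by (n ∸ 8) P₂₂₁ (n ∸ 8) P₄ 0 (patch∈ K P₂₂₁∈) (patch∈ K P₄∈) (same-base _) refl (start-vertex i v≡)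
  cover-start i {4} v≡ _ =
    covered-by 3 X 3 Y 0 (X∈ 1<K) (Y∈ 1<K) refl refl (low-vertex 3 1 i v≡)
  cover-start i {5} v≡ _ =
    covered-by (n ∸ 8) P₃ 3 Y 11 (patch∈ K P₃∈) (Y∈ 1<K) (wrap 3) refl (start-vertex i v≡)
  cover-start i {suc (suc (suc (suc (suc (suc _)))))} _ (s≤s (s≤s (s≤s (s≤s (s≤s (s≤s ()))))))

  middle-index : ∀ r k → r + (k + 2) * 3 ≤ n ∸ 8 → k + 2 < K
  middle-index r k bound = m+n≤o⇒m≤o∸n (suc (k + 2)) (subst (_≤ m) (lemma₁ k) (≤-pred k+5<1+m))
    where
      open ≤-Reasoning
      lemma₁ : ∀ k → k + 5 ≡ suc (k + 2) + 2
      lemma₁ = solve-∀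
      lemma₂ : ∀ k → 3 * (k + 5) ≡ (k + 2) * 3 + 9
      lemma₂ = solve-∀
      lemma₃ : ∀ m → suc (3 * m + 1 + 1) ≡ 3 * suc m
      lemma₃ = solve-∀
      k+5<1+m : k + 5 < suc m
      k+5<1+m = *-cancelˡ-< 3 (k + 5) (suc m) (begin-strict
        3 * (k + 5)             ≡⟨ lemma₂ k ⟩
        (k + 2) * 3 + 9         ≤⟨ +-monoˡ-≤ 9 (≤-trans (m≤n+m _ r) bound) ⟩
        n ∸ 8 + 9               ≡⟨ +-assoc (n ∸ 8) 8 1 ⟨
        n ∸ 8 + 8 + 1           ≡⟨ cong (_+ 1) (trans n∸8+8≡n n≡3m+1) ⟩
        3 * m + 1 + 1           <⟨ ≤-reflexive (lemma₃ m) ⟩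
        3 * suc m               ∎)

  cover-middle : ∀ i {r k} → toℕ i ≡ r + (k + 2) * 3 → r < 3 → toℕ i ≤ n ∸ 8 → Covered i
  cover-middle i {0} {k} v≡ _ v≤ =
    covered-by (3 * k) Y (3 * (k + 2)) X 6 (Y∈ k<K) (X∈ k+2<K) (step k 2) refl
      (low-vertex (3 * k) 6 i (trans v≡ (lemma k)))
    where
      k+2<K = middle-index 0 k (subst (_≤ n ∸ 8) v≡ v≤)
      k<K = <-trans (m<m+n k z<s) k+2<K
      lemma : ∀ k → 0 + (k + 2) * 3 ≡ 3 * k + 6
      lemma = solve-∀
  cover-middle i {1} {k} v≡ _ v≤ =
    covered-by (3 * (k + 2)) X (3 * (k + 2)) Y 0 (X∈ k+2<K) (Y∈ k+2<K) (same-base _) refl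
      (low-vertex (3 * (k + 2)) 1 i (trans v≡ (lemma k)))
    where
      k+2<K = middle-index 1 k (subst (_≤ n ∸ 8) v≡ v≤)
      lemma : ∀ k → 1 + (k + 2) * 3 ≡ 3 * (k + 2) + 1
      lemma = solve-∀
  cover-middle i {2} {k} v≡ _ v≤ =
    covered-by (3 * k) X (3 * (k + 2)) Y 6 (X∈ k<K) (Y∈ k+2<K) (step k 2) refl
      (low-vertex (3 * k) 8 i (trans v≡ (lemma k)))
    where
      k+2<K = middle-index 2 k (subst (_≤ n ∸ 8) v≡ v≤)
      k<K = <-trans (m<m+n k z<s) k+2<K
      lemma : ∀ k → 2 + (k + 2) * 3 ≡ 3 * k + 8
      lemma = solve-∀
  cover-middle i {suc (suc (suc _))} _ (s≤s (s≤s (s≤s ()))) _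

  +3≤m⇒<K : ∀ {j} → j + 3 ≤ m → j < K
  +3≤m⇒<K {j} j+3≤m = m+n≤o⇒m≤o∸n (suc j) (subst (_≤ m) (+-suc j 2) j+3≤m)

  end-vertex : ∀ (i : Fin n) {o} → toℕ i ≡ n ∸ 8 + o → vertex (n ∸ 8) o ≡ i
  end-vertex i {o} = low-vertex (n ∸ 8) o i

  near-end-vertex : ∀ (i : Fin n) j t {o} → j + 3 + t ≡ m → toℕ i ≡ n ∸ 8 + o → vertex (3 * j) (2 + 3 * t + o) ≡ i
  near-end-vertex i j t {o} eq v≡ =
    trans (sym (vertex-rebase (3 * j) (n ∸ 8) (2 + 3 * t) o (toward-end j t eq))) (end-vertex i v≡)

  j₀ j₁ : ℕ
  j₀ = m ∸ 3
  j₁ = m ∸ 4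

  eq₀ : j₀ + 3 + 0 ≡ m
  eq₀ = trans (+-identityʳ _) (m∸n+n≡m (≤-trans (m≤m+n 3 5) 8≤m))

  eq₁ : j₁ + 3 + 1 ≡ m
  eq₁ = trans (+-assoc j₁ 3 1) (m∸n+n≡m (≤-trans (m≤m+n 4 4) 8≤m))

  j₀<K : j₀ < K
  j₀<K = +3≤m⇒<K (≤-trans (m≤m+n (j₀ + 3) 0) (≤-reflexive eq₀))

  j₁<K : j₁ < K
  j₁<K = +3≤m⇒<K (≤-trans (m≤m+n (j₁ + 3) 1) (≤-reflexive eq₁))

  cover-end : ∀ i {o} → toℕ i ≡ n ∸ 8 + o → 0 < o → o < 8 → Covered i
  cover-end i {1} v≡ _ _ =
    covered-by (3 * j₁) Y (n ∸ 8) P₁ 5 (Y∈ j₁<K) (patch∈ K P₁∈) (toward-end j₁ 1 eq₁) refl (near-end-vertex i j₁ 1 eq₁ v≡)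
  cover-end i {2} v≡ _ _ =
    covered-by (n ∸ 8) P₁ (n ∸ 8) P₅ 0 (patch∈ K P₁∈) (patch∈ K P₅∈) (same-base _) refl (end-vertex i v≡)
  cover-end i {3} v≡ _ _ =
    covered-by (3 * j₁) X (n ∸ 8) P₅ 5 (X∈ j₁<K) (patch∈ K P₅∈) (toward-end j₁ 1 eq₁) refl (near-end-vertex i j₁ 1 eq₁ v≡)
  cover-end i {4} v≡ _ _ =
    covered-by (3 * j₀) Y (n ∸ 8) P₅ 2 (Y∈ j₀<K) (patch∈ K P₅∈) (toward-end j₀ 0 eq₀) refl (near-end-vertex i j₀ 0 eq₀ v≡)
  cover-end i {5} v≡ _ _ =
    covered-by (n ∸ 8) P₄ (n ∸ 8) P₅ 0 (patch∈ K P₄∈) (patch∈ K P₅∈) (same-base _) refl (end-vertex i v≡)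
  cover-end i {6} v≡ _ _ =
    covered-by (3 * j₀) X (n ∸ 8) P₃ 2 (X∈ j₀<K) (patch∈ K P₃∈) (toward-end j₀ 0 eq₀) refl (near-end-vertex i j₀ 0 eq₀ v≡)
  cover-end i {7} v≡ _ _ =
    covered-by (n ∸ 8) P₂₂₁ (n ∸ 8) P₃ 0 (patch∈ K P₂₂₁∈) (patch∈ K P₃∈) (same-base _) refl (end-vertex i v≡)
  cover-end i {suc (suc (suc (suc (suc (suc (suc (suc _)))))))} _ _ (s≤s (s≤s (s≤s (s≤s (s≤s (s≤s (s≤s (s≤s ()))))))))

  covers : Covers H
  covers i with toℕ i <? 6 | toℕ i ≤? n ∸ 8
  ... | yes v<6 | _ = cover-start i refl v<6
  ... | no v≮6 | yes v≤n∸8 = cover-middle i {k = toℕ i / 3 ∸ 2} v≡ (m%n<n (toℕ i) 3) v≤n∸8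
    where
      2≤v/3 : 2 ≤ toℕ i / 3
      2≤v/3 = /-monoˡ-≤ 3 (≮⇒≥ v≮6)
      v≡ : toℕ i ≡ toℕ i % 3 + (toℕ i / 3 ∸ 2 + 2) * 3
      v≡ = trans (m≡m%n+[m/n]*n (toℕ i) 3) (cong (λ q → toℕ i % 3 + q * 3) (sym (m∸n+n≡m 2≤v/3)))
  ... | no _ | no v≰n∸8 = cover-end i v≡ (m<n⇒0<n∸m n∸8<v) o<8
    where
      n∸8<v = ≰⇒> v≰n∸8
      o = toℕ i ∸ (n ∸ 8)
      v≡ : toℕ i ≡ n ∸ 8 + o
      v≡ = sym (m+[n∸m]≡n (<⇒≤ n∸8<v))
      o<8 : o < 8
      o<8 = +-cancelˡ-< (n ∸ 8) o 8 (subst₂ _<_ v≡ (sym n∸8+8≡n) (Fin.toℕ<n i))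

thirds : ∀ n → 19 ≤ n → n % 3 ≡ 1 → ∃ λ k → (n ∸ 1) / 3 ≡ 6 + k × n ≡ 3 * (6 + k) + 1
thirds n 19≤n n%3≡1 = m ∸ 6 , m≡6+k , trans n≡3m+1 (cong (λ m → 3 * m + 1) m≡6+k)
  where
    open ≡-Reasoning
    m = (n ∸ 1) / 3
    n∸1≡n/3*3 : n ∸ 1 ≡ n / 3 * 3
    n∸1≡n/3*3 = cong (_∸ 1) (trans (m≡m%n+[m/n]*n n 3) (cong (_+ n / 3 * 3) n%3≡1))
    n≡3m+1 : n ≡ 3 * m + 1
    n≡3m+1 = begin
      n                  ≡⟨ m≡m%n+[m/n]*n n 3 ⟩
      n % 3 + n / 3 * 3  ≡⟨ cong (_+ n / 3 * 3) n%3≡1 ⟩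
      1 + n / 3 * 3      ≡⟨ cong (λ q → 1 + q * 3) (trans (cong (_/ 3) n∸1≡n/3*3) (m*n/n≡m (n / 3) 3)) ⟨
      1 + m * 3          ≡⟨ +-comm 1 (m * 3) ⟩
      m * 3 + 1          ≡⟨ cong (_+ 1) (*-comm m 3) ⟩
      3 * m + 1          ∎
    m≡6+k : m ≡ 6 + (m ∸ 6)
    m≡6+k = sym (m+[n∸m]≡n (*-cancelˡ-≤ {6} 3 (+-cancelʳ-≤ 1 18 (3 * m) (subst (19 ≤_) n≡3m+1 19≤n))))

-- For n = 19 and n = 22 the estimates of General do not apply; there both facts are decided by evaluation.
meets-and-covers : ∀ {n} .{{_ : NonZero n}} k → n ≡ 3 * (6 + k) + 1 →
                   AllPairs CycleMeet (construction {n} (4 + k)) × Covers (construction {n} (4 + k))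
meets-and-covers 0 refl = from-yes (AllPairs.allPairs? cycleMeet? (construction 4) ×-dec covers? (construction 4))
meets-and-covers 1 refl = from-yes (AllPairs.allPairs? cycleMeet? (construction 5) ×-dec covers? (construction 5))
meets-and-covers k@(suc (suc _)) n≡ =
  General.meets (6 + k) n≡ (s≤s (s≤s (s≤s (s≤s (s≤s (s≤s (s≤s (s≤s z≤n)))))))) ,
  General.covers (6 + k) n≡ (s≤s (s≤s (s≤s (s≤s (s≤s (s≤s (s≤s (s≤s z≤n))))))))

lemma2 : (n : ℕ) .{{_ : NonZero n}} → 19 ≤ n → n % 3 ≡ 1 →
    Σ (Hypergraph n) λ H →
        Uniform 5 H
      × EIisCycle H
      × length (edges H) ≡ 2 * ((n ∸ 1) / 3) + 1
      × (∃ λ e₅ → e₅ ∈ edges H × IsTypeHyperedge (5 ∷ []) e₅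
          × (∀ e → e ∈ edges H → IsTypeHyperedge (5 ∷ []) e → e ≡ e₅)
          × ∃ λ e₂₂₁ → e₂₂₁ ∈ edges H × IsTypeHyperedge (2 ∷ 2 ∷ 1 ∷ []) e₂₂₁
          × (∀ e → e ∈ edges H → IsTypeHyperedge (2 ∷ 2 ∷ 1 ∷ []) e → e ≡ e₂₂₁)
          × (∀ e → e ∈ edges H → e ≢ e₅ → e ≢ e₂₂₁ → IsTypeHyperedge (3 ∷ 2 ∷ []) e))
lemma2 n 19≤n n%3≡1
  with k , m≡6+k , n≡ ← thirds n 19≤n n%3≡1
  with meets , covers ← meets-and-covers k n≡ =
  hypergraph , (λ _ → All.lookup uniform) , EIisCycle-hypergraph (≤-trans (m≤m+n 2 17) 19≤n) covers ,
  trans (length-construction (4 + k)) (trans (lemma k) (cong (λ m → 2 * m + 1) (sym m≡6+k))) ,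
  e₅ , patch∈ (4 + k) P₅∈ , typed 19≤n P₅ , (λ _ → All.lookup only-e₅) ,
  e₂₂₁ , patch∈ (4 + k) P₂₂₁∈ , typed 19≤n P₂₂₁ , (λ _ → All.lookup only-e₂₂₁) , (λ _ → All.lookup others-32)
  where
    open Types 19≤n (4 + k)
    open CycleMeets (construction (4 + k)) large meets
    lemma : ∀ k → 4 + k + (4 + k + 5) ≡ 2 * (6 + k) + 1
    lemma = solve-∀
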